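{- Let $\Sigma$ be a finite ordered alphabet, let $\ell\ge 1$, and let $\mathcal{L}$ be a finite language of necklaces over $\Sigma$, all of length $\ell$. Let $k\ge 1$ and let $S\subseteq\mathcal{L}$ be a set of $k$ centres. Let $\lambda\ge 1$ be the longest length such that every word in $\mathcal{L}$ shares a subword of length $\lambda$ with at least one centre in $S$. Then $$\mathfrak{D}_{\mathcal{L},k}\le \frac{2\ell^2}{\lambda(\lambda+1)}.$$
   Context: A necklace (cyclic word) of length $n$ over $\Sigma$ is an equivalence class of words of $\Sigma^n$ under cyclic shift; its canonical representative is the lexicographically smallest word in the class. A word $u$ is a subword of a necklace if it is a factor of some rotation of (a representative of) it, i.e. a cyclic factor. Two necklaces share a subword of length $\lambda$ if some word of length $\lambda$ is a subword of both. Same-length representatives: for necklaces $\alpha,\beta$ of lengths $m,n$ with representatives $u,v$, take $a=u^{N/m}$, $b=v^{N/n}$ with $N=\mathrm{lcm}(m,n)$. For a word $a=a_1\cdots a_N$ read cyclically, its multiset of subwords $M(a)$ consists, for every length $l\in\{1,\dots,N\}$ and every starting position $i\in\{1,\dots,N\}$, of the cyclic factor of length $l$ starting at position $i$, labelled by the number of its occurrences among starting positions $\le i$ (so $|M(a)|=N^2$). The overlap coefficient is $\mathfrak{C}(\alpha,\beta)=\frac{|M(a)\cap M(b)|}{\min(|M(a)|,|M(b)|)}$, and the overlap distance is $\mathfrak{O}(\alpha,\beta)=\infty$ if $\mathfrak{C}(\alpha,\beta)=0$, $0$ if $\mathfrak{C}(\alpha,\beta)=1$, and $1/\mathfrak{C}(\alpha,\beta)$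 otherwise. For a finite language $\mathcal{L}$ of necklaces and integer $k$, the $k$-centre problem asks for $S\subseteq\mathcal{L}$ with $|S|=k$ minimising $\max_{v\in\mathcal{L}}\min_{s\in S}\mathfrak{O}(s,v)$; the optimal value is $\mathfrak{D}_{\mathcal{L},k}=\min_{|S|=k}\max_{v\in\mathcal{L}}\min_{s\in S}\mathfrak{O}(s,v)$. -}

module Defs where

open import Data.Nat using (ℕ; zero; suc; _+_; _*_; _≤_; _<_; NonZero)
open import Data.Nat.DivMod using (_mod_)
import Data.Nat as ℕ
open import Data.Fin using (Fin; toℕ)
import Data.Fin.Properties as FinP
open import Data.Vec using (Vec; []; _∷_; lookup; tabulate)
open import Data.Vec.Properties using (≡-dec)
open import Data.Bool using (Bool; true; false; _∧_; if_then_else_)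
open import Data.Maybe using (Maybe; just; nothing)
open import Data.List using (List)
open import Data.List.Membership.Propositional using (_∈_)
open import Data.List.Relation.Unary.Unique.Propositional using (Unique)
open import Data.Product using (Σ; ∃; _×_)
open import Data.Sum using (_⊎_)
open import Data.Integer using (+_)
open import Data.Rational using (ℚ; _/_; 0ℚ) renaming (_≤_ to _≤ℚ_)
open import Relation.Nullary.Decidable using (⌊_⌋)
open import Relation.Binary.PropositionalEquality using (_≡_)

Word : ℕ → ℕ → Set
Word σ ℓ = Vec (Fin σ) ℓ

cyc : ∀ {σ ℓ} .{{_ : NonZero ℓ}} → Word σ ℓ → ℕ → Fin σ
cyc {ℓ = ℓ} w p = lookup w (p mod ℓ)

fac : ∀ {σ ℓ} .{{_ : NonZero ℓ}} → Word σ ℓ → ℕ → (l : ℕ) → Vec (Fin σ) l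
fac w i l = tabulate (λ j → cyc w (i + toℕ j))

rotate : ∀ {σ ℓ} .{{_ : NonZero ℓ}} → ℕ → Word σ ℓ → Word σ ℓ
rotate {ℓ = ℓ} r w = fac w r ℓ

data _<lex_ {σ : ℕ} : ∀ {n} → Vec (Fin σ) n → Vec (Fin σ) n → Set where
  here : ∀ {n x y} {xs ys : Vec (Fin σ) n} → toℕ x < toℕ y → (x ∷ xs) <lex (y ∷ ys)
  there : ∀ {n x} {xs ys : Vec (Fin σ) n} → xs <lex ys → (x ∷ xs) <lex (x ∷ ys)

_≤lex_ : ∀ {σ n} → Vec (Fin σ) n → Vec (Fin σ) n → Set
u ≤lex v = u <lex v ⊎ u ≡ v

-- w is the canonical representative of its necklace:
-- lexicographically smallest among its rotations.
IsNecklace : ∀ {σ ℓ} .{{_ : NonZero ℓ}} → Word σ ℓ → Set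
IsNecklace {ℓ = ℓ} w = ∀ r → r < ℓ → w ≤lex rotate r w

SubwordOf : ∀ {σ ℓ μ} .{{_ : NonZero ℓ}} → Vec (Fin σ) μ → Word σ ℓ → Set
SubwordOf {ℓ = ℓ} {μ} u w = μ ≤ ℓ × Σ ℕ (λ i → i < ℓ × fac w i μ ≡ u)

count : (ℕ → Bool) → ℕ → ℕ
count p zero = zero
count p (suc n) = if p n then suc (count p n) else count p n

anyBelow : (ℕ → Bool) → ℕ → Bool
anyBelow p zero = false
anyBelow p (suc n) = if p n then true else anyBelow p n

eqFac : ∀ {σ l} → Vec (Fin σ) l → Vec (Fin σ) l → Bool
eqFac u v = ⌊ ≡-dec FinP._≟_ u v ⌋

-- label of the element of M(w) at (length l, start i):
-- number of occurrences of fac w i l among starting positions ≤ i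
label : ∀ {σ ℓ} .{{_ : NonZero ℓ}} → Word σ ℓ → ℕ → ℕ → ℕ
label w l i = count (λ i' → eqFac (fac w i' l) (fac w i l)) (suc i)

-- is the labelled element (fac a i l, label a l i) of M(a) also in M(b) ?
inM : ∀ {σ ℓ} .{{_ : NonZero ℓ}} → Word σ ℓ → Word σ ℓ → ℕ → ℕ → Bool
inM {ℓ = ℓ} a b l i =
  anyBelow (λ i' → eqFac (fac b i' l) (fac a i l)
                   ∧ ⌊ label b l i' ℕ.≟ label a l i ⌋) ℓ

-- |M(a) ∩ M(b)|, summing over lengths l = 1 .. ℓ and starts i = 0 .. ℓ-1
sumLen : (ℕ → ℕ) → ℕ → ℕ
sumLen f zero = zero
sumLen f (suc n) = f (suc n) + sumLen f n

interSize : ∀ {σ ℓ} .{{_ : NonZero ℓ}} → Word σ ℓ → Word σ ℓ → ℕ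
interSize {ℓ = ℓ} a b = sumLen (λ l → count (inM a b l) ℓ) ℓ

-- Overlap distance of two necklaces of the same length ℓ
-- (then N = lcm(ℓ,ℓ) = ℓ, a = u, b = v, and |M(a)| = |M(b)| = ℓ²).
-- Value 'nothing' encodes ∞.
-- C = I / ℓ²; O = ∞ if I = 0, 0 if I = ℓ², and ℓ² / I otherwise.
overlapDist : ∀ {σ ℓ} .{{_ : NonZero ℓ}} → Word σ ℓ → Word σ ℓ → Maybe ℚ
overlapDist {ℓ = ℓ} a b with interSize a b
... | zero = nothing
... | suc j = if ⌊ suc j ℕ.≟ ℓ * ℓ ⌋ then just 0ℚ else just ((+ (ℓ * ℓ)) / suc j)

IsCentreSet : ∀ {σ ℓ} → List (Word σ ℓ) → ℕ → List (Word σ ℓ) → Set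
IsCentreSet L k S = Unique S × (∀ {s} → s ∈ S → s ∈ L) × Data.List.length S ≡ k
  where import Data.List

AllShare : ∀ {σ ℓ} .{{_ : NonZero ℓ}} → List (Word σ ℓ) → List (Word σ ℓ) → ℕ → Set
AllShare {σ} L S μ =
  ∀ {v} → v ∈ L → Σ (Word _ _) λ s → s ∈ S × Σ (Vec (Fin σ) μ) λ u → SubwordOf u s × SubwordOf u v

-- D_{L,k} ≤ r  (r finite), i.e.
-- min_{S ⊆ L, |S| = k} max_{v ∈ L} min_{s ∈ S} O(s,v) ≤ r,
-- unfolded for finite nonempty min/max: some admissible S achieves
-- O(s,v) ≤ r (finite) for a suitable s ∈ S, for every v ∈ L.
OptAtMost : ∀ {σ ℓ} .{{_ : NonZero ℓ}} → List (Word σ ℓ) → ℕ → ℚ → Set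
OptAtMost L k r =
  Σ (List (Word _ _)) λ S → IsCentreSet L k S ×
    (∀ {v} → v ∈ L → Σ (Word _ _) λ s → s ∈ S × Σ ℚ λ q → overlapDist s v ≡ just q × q ≤ℚ r)

bound : (ℓ λ' : ℕ) .{{_ : NonZero λ'}} → ℚ
bound ℓ (suc m) = (+ (2 * ℓ * ℓ)) / (suc m * suc (suc m))

-- If s and v share a word u of length λ, then for every l ≤ λ the λ + 1 − l factors of u of
-- length l (with multiplicity) are cyclic factors of both s and v, and the factors of one copy of u
-- sit at distinct positions modulo ℓ because λ ≤ ℓ. Pairing the occurrences of each factor in s and
-- in v by their rank (the label of M) yields λ + 1 − l common elements of M(s) and M(v), so
-- |M(s) ∩ M(v)| ≥ λ(λ + 1)/2 and 𝔒(s, v) ≤ 2ℓ²/(λ(λ + 1)). The given centres S witness the bound.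
module Submission where

open import Defs
open import Data.Bool using (true; false; _∧_)
open import Data.Nat using (ℕ; zero; suc; pred; _+_; _*_; _∸_; _≤_; _<_; _≤′_; _≤?_; z≤n; s≤s; z<s; ≤′-refl; ≤′-step; NonZero)
  renaming (_≟_ to _≟ℕ_)
open import Data.Nat.Properties
open import Data.Nat.DivMod using (_mod_; _%_; [m+n]%n≡m%n; m<n⇒m%n≡m)
open import Data.Nat.Solver using (module +-*-Solver)
open +-*-Solver using (solve; _:+_; _:*_; _:=_; con)
open import Data.Fin using (Fin; toℕ)
import Data.Fin.Properties as FinP
open import Data.Vec using (Vec; lookup)
open import Data.Vec.Properties using (≡-dec; tabulate-cong; lookup∘tabulate)
open import Data.List using (List; []; _∷_; length; applyDownFrom)
open import Data.List.Properties using (length-applyDownFrom)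
open import Data.List.Relation.Unary.All using (All)
open import Data.List.Relation.Unary.Unique.Propositional using (Unique)
open import Data.Maybe using (just)
open import Data.Product using (Σ; _×_; _,_; proj₁; map₁; map₂)
open import Data.Integer as ℤ using (+≤+)
open import Data.Integer.Properties using (pos-*)
open import Data.Rational using (ℚ; _/_; 0ℚ) renaming (_≤_ to _≤ℚ_)
open import Data.Rational.Properties using (toℚᵘ-cancel-≤; toℚᵘ-fromℚᵘ; 0/n≡0)
import Data.Rational.Unnormalised.Base as ℚᵘ
import Data.Rational.Unnormalised.Properties as ℚᵘ
open import Relation.Binary.Definitions using (DecidableEquality)
open import Relation.Binary.PropositionalEquality
open import Relation.Nullary using (Dec; yes; no; ¬_; contradiction)
open import Relation.Nullary.Decidable using (⌊_⌋)

isYes-true : ∀ {p} {P : Set p} (P? : Dec P) → P → ⌊ P? ⌋ ≡ true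
isYes-true (yes _) _ = refl
isYes-true (no ¬p) p = contradiction p ¬p

isYes-false : ∀ {p} {P : Set p} (P? : Dec P) → ¬ P → ⌊ P? ⌋ ≡ false
isYes-false (yes p) ¬p = contradiction p ¬p
isYes-false (no _) _ = refl

isYes-true⁻¹ : ∀ {p} {P : Set p} (P? : Dec P) → ⌊ P? ⌋ ≡ true → P
isYes-true⁻¹ (yes p) _ = p

count-cong : ∀ {p q} n → (∀ i → i < n → p i ≡ q i) → count p n ≡ count q n
count-cong zero _ = refl
count-cong {p} {q} (suc n) p≗q with p n | q n | p≗q n ≤-refl
... | b | .b | refl rewrite count-cong n (λ i i<n → p≗q i (m≤n⇒m≤1+n i<n)) = refl

count-+ : ∀ p m n → count p (m + n) ≡ count p m + count (λ i → p (m + i)) n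
count-+ p m zero = trans (cong (count p) (+-identityʳ m)) (sym (+-identityʳ (count p m)))
count-+ p m (suc n) rewrite +-suc m n with p (m + n)
... | true = trans (cong suc (count-+ p m n)) (sym (+-suc _ _))
... | false = count-+ p m n

count-rotate : ∀ p n r → (∀ i → p (i + n) ≡ p i) → count (λ i → p (r + i)) n ≡ count p n
count-rotate p n r periodic = +-cancelˡ-≡ (count p r) _ _ (begin
  count p r + count (λ i → p (r + i)) n ≡⟨ count-+ p r n ⟨
  count p (r + n)                       ≡⟨ cong (count p) (+-comm r n) ⟩
  count p (n + r)                       ≡⟨ count-+ p n r ⟩
  count p n + count (λ i → p (n + i)) r ≡⟨ cong (count p n +_) (count-cong r (λ i _ → trans (cong p (+-comm n i)) (periodic i))) ⟩
  count p n + count p r                 ≡⟨ +-comm (count p n) (count p r) ⟩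
  count p r + count p n                 ∎)
  where open ≡-Reasoning

count-monoʳ-≤ : ∀ p {m n} → m ≤ n → count p m ≤ count p n
count-monoʳ-≤ p m≤n = go (≤⇒≤′ m≤n)
  where
  go : ∀ {m n} → m ≤′ n → count p m ≤ count p n
  go ≤′-refl = ≤-refl
  go {n = suc n} (≤′-step m≤′n) with p n
  ... | true = m≤n⇒m≤1+n (go m≤′n)
  ... | false = go m≤′n

count-monoˡ : ∀ {p q} n → (∀ i → p i ≡ true → q i ≡ true) → count p n ≤ count q n
count-monoˡ zero _ = z≤n
count-monoˡ {p} {q} (suc n) p⇒q with p n in pn | q n in qn
... | true | true = s≤s (count-monoˡ n p⇒q)
... | true | false = contradiction (trans (sym (p⇒q n pn)) qn) λ ()
... | false | true = m≤n⇒m≤1+n (count-monoˡ n p⇒q)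
... | false | false = count-monoˡ n p⇒q

anyBelow-true : ∀ p {n i} → i < n → p i ≡ true → anyBelow p n ≡ true
anyBelow-true p {suc n} {i} i<1+n pi≡true with p n in pn
... | true = refl
... | false with i ≟ℕ n
...   | yes refl = contradiction (trans (sym pi≡true) pn) λ ()
...   | no i≢n = anyBelow-true p (≤∧≢⇒< (≤-pred i<1+n) i≢n) pi≡true

sumLen-monoˡ-≤ : ∀ {F G} n → (∀ t → suc t ≤ n → F (suc t) ≤ G (suc t)) → sumLen F n ≤ sumLen G n
sumLen-monoˡ-≤ zero _ = z≤n
sumLen-monoˡ-≤ (suc n) F≤G = +-mono-≤ (F≤G n ≤-refl) (sumLen-monoˡ-≤ n (λ t t<n → F≤G t (m≤n⇒m≤1+n t<n)))

sumLen-monoʳ-≤ : ∀ F {m n} → m ≤ n → sumLen F m ≤ sumLen F n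
sumLen-monoʳ-≤ F m≤n = go (≤⇒≤′ m≤n)
  where
  go : ∀ {m n} → m ≤′ n → sumLen F m ≤ sumLen F n
  go ≤′-refl = ≤-refl
  go {n = suc n} (≤′-step m≤′n) = ≤-trans (go m≤′n) (m≤n+m _ (F (suc n)))

sumLen-descending : ∀ n d → 2 * sumLen (λ l → suc (n + d) ∸ l) n ≡ n * suc n + 2 * n * d
sumLen-descending zero d = refl
sumLen-descending (suc n) d = begin
  2 * (suc (n + d) ∸ n + sumLen (λ l → suc (suc (n + d)) ∸ l) n)
    ≡⟨ cong (λ m → 2 * (m ∸ n + sumLen (λ l → suc m ∸ l) n)) (+-suc n d) ⟨
  2 * (n + suc d ∸ n + sumLen (λ l → suc (n + suc d) ∸ l) n)
    ≡⟨ cong (λ m → 2 * (m + sumLen (λ l → suc (n + suc d) ∸ l) n)) (m+n∸m≡n n (suc d)) ⟩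
  2 * (suc d + sumLen (λ l → suc (n + suc d) ∸ l) n)
    ≡⟨ *-distribˡ-+ 2 (suc d) _ ⟩
  2 * suc d + 2 * sumLen (λ l → suc (n + suc d) ∸ l) n
    ≡⟨ cong (2 * suc d +_) (sumLen-descending n (suc d)) ⟩
  2 * suc d + (n * suc n + 2 * n * suc d)
    ≡⟨ solve 2 (λ n d → con 2 :* (con 1 :+ d) :+ (n :* (con 1 :+ n) :+ con 2 :* n :* (con 1 :+ d))
                        := (con 1 :+ n) :* (con 2 :+ n) :+ con 2 :* (con 1 :+ n) :* d) refl n d ⟩
  suc n * suc (suc n) + 2 * suc n * d ∎
  where open ≡-Reasoning

double-sumLen-descending : ∀ n → 2 * sumLen (λ l → suc n ∸ l) n ≡ n * suc n
double-sumLen-descending n = begin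
  2 * sumLen (λ l → suc n ∸ l) n       ≡⟨ cong (λ m → 2 * sumLen (λ l → suc m ∸ l) n) (+-identityʳ n) ⟨
  2 * sumLen (λ l → suc (n + 0) ∸ l) n ≡⟨ sumLen-descending n 0 ⟩
  n * suc n + 2 * n * 0                ≡⟨ cong (n * suc n +_) (*-zeroʳ (2 * n)) ⟩
  n * suc n + 0                        ≡⟨ +-identityʳ (n * suc n) ⟩
  n * suc n                            ∎
  where open ≡-Reasoning

*≤*⇒/≤/ : ∀ a b c d → a * suc d ≤ c * suc b → ℤ.+ a / suc b ≤ℚ ℤ.+ c / suc d
*≤*⇒/≤/ a b c d ad≤cb = toℚᵘ-cancel-≤
  (ℚᵘ.≤-respˡ-≃ (ℚᵘ.≃-sym (toℚᵘ-fromℚᵘ (ℚᵘ.mkℚᵘ (ℤ.+ a) b)))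
    (ℚᵘ.≤-respʳ-≃ (ℚᵘ.≃-sym (toℚᵘ-fromℚᵘ (ℚᵘ.mkℚᵘ (ℤ.+ c) d)))
      (ℚᵘ.*≤* (subst₂ ℤ._≤_ (pos-* a (suc d)) (pos-* c (suc b)) (+≤+ ad≤cb)))))

module Occurrences {a} {A : Set a} (_≟_ : DecidableEquality A) where

  multiplicity : A → List A → ℕ
  multiplicity w [] = 0
  multiplicity w (x ∷ xs) with x ≟ w
  ... | yes _ = suc (multiplicity w xs)
  ... | no _ = multiplicity w xs

  removeFirst : A → List A → List A
  removeFirst w [] = []
  removeFirst w (x ∷ xs) with x ≟ w
  ... | yes _ = xs
  ... | no _ = x ∷ removeFirst w xs

  multiplicity-head : ∀ x xs → multiplicity x (x ∷ xs) ≡ suc (multiplicity x xs)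
  multiplicity-head x xs with x ≟ x
  ... | yes _ = refl
  ... | no x≢x = contradiction refl x≢x

  length-removeFirst : ∀ w xs → length xs ≤ suc (length (removeFirst w xs))
  length-removeFirst w [] = z≤n
  length-removeFirst w (x ∷ xs) with x ≟ w
  ... | yes _ = ≤-refl
  ... | no _ = s≤s (length-removeFirst w xs)

  multiplicity-removeFirst : ∀ w xs → multiplicity w (removeFirst w xs) ≡ pred (multiplicity w xs)
  multiplicity-removeFirst w [] = refl
  multiplicity-removeFirst w (x ∷ xs) with x ≟ w
  ... | yes _ = refl
  ... | no x≢w with x ≟ w
  ...   | yes x≡w = contradiction x≡w x≢w
  ...   | no _ = multiplicity-removeFirst w xs

  multiplicity-tail-≤ : ∀ w x xs → multiplicity w xs ≤ multiplicity w (x ∷ xs)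
  multiplicity-tail-≤ w x xs with x ≟ w
  ... | yes _ = n≤1+n _
  ... | no _ = ≤-refl

  multiplicity-removeFirst-≤ : ∀ w w′ xs → multiplicity w′ (removeFirst w xs) ≤ multiplicity w′ xs
  multiplicity-removeFirst-≤ w w′ [] = z≤n
  multiplicity-removeFirst-≤ w w′ (x ∷ xs) with x ≟ w
  ... | yes _ = multiplicity-tail-≤ w′ x xs
  ... | no _ with x ≟ w′
  ...   | yes _ = s≤s (multiplicity-removeFirst-≤ w w′ xs)
  ...   | no _ = multiplicity-removeFirst-≤ w w′ xs

  occurrences : (ℕ → A) → A → ℕ → ℕ
  occurrences f w n = count (λ i → ⌊ f i ≟ w ⌋) n

  -- label w l i of Defs is rank (λ i → fac w i l) i.
  rank : (ℕ → A) → ℕ → ℕ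
  rank f i = occurrences f (f i) (suc i)

  occurrences-here : ∀ f {w} n → f n ≡ w → occurrences f w (suc n) ≡ suc (occurrences f w n)
  occurrences-here f {w} n fn≡w rewrite isYes-true (f n ≟ w) fn≡w = refl

  occurrences-elsewhere : ∀ f {w} n → f n ≢ w → occurrences f w (suc n) ≡ occurrences f w n
  occurrences-elsewhere f {w} n fn≢w rewrite isYes-false (f n ≟ w) fn≢w = refl

  occurrences-cong : ∀ {f g} w n → (∀ i → i < n → f i ≡ g i) → occurrences f w n ≡ occurrences g w n
  occurrences-cong w n f≗g = count-cong n (λ i i<n → cong (λ x → ⌊ x ≟ w ⌋) (f≗g i i<n))

  occurrences-rotate : ∀ f w n r → (∀ i → f (i + n) ≡ f i) →
                       occurrences (λ i → f (r + i)) w n ≡ occurrences f w n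
  occurrences-rotate f w n r periodic = count-rotate _ n r (λ i → cong (λ x → ⌊ x ≟ w ⌋) (periodic i))

  multiplicity-applyDownFrom : ∀ f w n → multiplicity w (applyDownFrom f n) ≡ occurrences f w n
  multiplicity-applyDownFrom f w zero = refl
  multiplicity-applyDownFrom f w (suc n) with f n ≟ w
  ... | yes _ = cong suc (multiplicity-applyDownFrom f w n)
  ... | no _ = multiplicity-applyDownFrom f w n

  ≤-occurrences-prefix : ∀ f n xs → (∀ w → multiplicity w xs ≤ occurrences f w (suc n)) →
                         multiplicity (f n) xs ≤ occurrences f (f n) n →
                         ∀ w → multiplicity w xs ≤ occurrences f w n
  ≤-occurrences-prefix f n xs xs≤ xs≤fn w with f n ≟ w
  ... | yes refl = xs≤fn
  ... | no fn≢w = subst (multiplicity w xs ≤_) (occurrences-elsewhere f n fn≢w) (xs≤ w)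

  -- Greedy matching: position n is kept exactly when its rank is within K, and then consumes one
  -- copy of f n from xs.
  length≤count-rank≤ : ∀ f (K : A → ℕ) n xs →
                       (∀ w → multiplicity w xs ≤ occurrences f w n) → (∀ w → multiplicity w xs ≤ K w) →
                       length xs ≤ count (λ i → ⌊ rank f i ≤? K (f i) ⌋) n
  length≤count-rank≤ f K zero [] _ _ = z≤n
  length≤count-rank≤ f K zero (x ∷ xs) xs≤f _ =
    contradiction (subst (_≤ 0) (multiplicity-head x xs) (xs≤f x)) n≮0
  length≤count-rank≤ f K (suc n) xs xs≤f xs≤K with rank f n ≤? K (f n)
  ... | yes _ = ≤-trans (length-removeFirst (f n) xs) (s≤s (length≤count-rank≤ f K n xs′ xs′≤f xs′≤K))
    where
    xs′ : List A
    xs′ = removeFirst (f n) xs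
    xs′≤f : ∀ w → multiplicity w xs′ ≤ occurrences f w n
    xs′≤f = ≤-occurrences-prefix f n xs′ (λ w → ≤-trans (multiplicity-removeFirst-≤ (f n) w xs) (xs≤f w))
      (begin
        multiplicity (f n) xs′                  ≡⟨ multiplicity-removeFirst (f n) xs ⟩
        pred (multiplicity (f n) xs)            ≤⟨ pred-mono-≤ (xs≤f (f n)) ⟩
        pred (occurrences f (f n) (suc n))      ≡⟨ cong pred (occurrences-here f n refl) ⟩
        occurrences f (f n) n                   ∎)
      where open ≤-Reasoning
    xs′≤K : ∀ w → multiplicity w xs′ ≤ K w
    xs′≤K = λ w → ≤-trans (multiplicity-removeFirst-≤ (f n) w xs) (xs≤K w)
  ... | no rank≰K = length≤count-rank≤ f K n xs
    (≤-occurrences-prefix f n xs xs≤f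
      (≤-pred (≤-trans (s≤s (xs≤K (f n))) (subst (K (f n) <_) (occurrences-here f n refl) (≰⇒> rank≰K)))))
    xs≤K

  occurrence-of-rank : ∀ g w n k → 0 < k → k ≤ occurrences g w n →
                       Σ ℕ λ i → i < n × g i ≡ w × occurrences g w (suc i) ≡ k
  occurrence-of-rank g w zero k 0<k k≤ = contradiction (≤-trans 0<k k≤) n≮0
  occurrence-of-rank g w (suc n) k 0<k k≤ with g n ≟ w
  ... | no _ = map₂ (map₁ m≤n⇒m≤1+n) (occurrence-of-rank g w n k 0<k k≤)
  ... | yes gn≡w with k ≟ℕ suc (occurrences g w n)
  ...   | yes refl = n , ≤-refl , gn≡w , occurrences-here g n gn≡w
  ...   | no k≢ = map₂ (map₁ m≤n⇒m≤1+n) (occurrence-of-rank g w n k 0<k (≤-pred (≤∧≢⇒< k≤ k≢)))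

  rank-matched : ∀ f g i n → rank f i ≤ occurrences g (f i) n →
                 Σ ℕ λ i′ → i′ < n × g i′ ≡ f i × rank g i′ ≡ rank f i
  rank-matched f g i n rank≤ =
    let (i′ , i′<n , gi′≡fi , occurrences≡rank) = occurrence-of-rank g (f i) n (rank f i) 0<rank rank≤
    in i′ , i′<n , gi′≡fi , trans (cong (λ w → occurrences g w (suc i′)) gi′≡fi) occurrences≡rank
    where
    0<rank : 0 < rank f i
    0<rank = subst (0 <_) (sym (occurrences-here f i refl)) z<s

open module VecOccurrences {σ l : ℕ} = Occurrences {A = Vec (Fin σ) l} (≡-dec FinP._≟_)

module _ {σ ℓ : ℕ} .{{_ : NonZero ℓ}} where

  common-factors≤count-inM : ∀ (a b : Word σ ℓ) l (xs : List (Vec (Fin σ) l)) →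
    (∀ w → multiplicity w xs ≤ occurrences (λ i → fac a i l) w ℓ) →
    (∀ w → multiplicity w xs ≤ occurrences (λ i → fac b i l) w ℓ) →
    length xs ≤ count (inM a b l) ℓ
  common-factors≤count-inM a b l xs xs≤a xs≤b =
    ≤-trans (length≤count-rank≤ f K ℓ xs xs≤a xs≤b) (count-monoˡ ℓ rank≤K⇒inM)
    where
    f g : ℕ → Vec (Fin σ) l
    f i = fac a i l
    g i = fac b i l
    K : Vec (Fin σ) l → ℕ
    K w = occurrences g w ℓ
    rank≤K⇒inM : ∀ i → ⌊ rank f i ≤? K (f i) ⌋ ≡ true → inM a b l i ≡ true
    rank≤K⇒inM i rank≤K =
      let (i′ , i′<ℓ , same-factor , same-rank) = rank-matched f g i ℓ (isYes-true⁻¹ (rank f i ≤? K (f i)) rank≤K)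
      in anyBelow-true _ i′<ℓ
           (cong₂ _∧_ (isYes-true (≡-dec FinP._≟_ (g i′) (f i)) same-factor)
                       (isYes-true (rank g i′ ≟ℕ rank f i) same-rank))

  fac-periodic : ∀ (a : Word σ ℓ) i l → fac a (i + ℓ) l ≡ fac a i l
  fac-periodic a i l = tabulate-cong λ j → cong (lookup a) (FinP.fromℕ<-cong _ _ (begin
    (i + ℓ + toℕ j) % ℓ   ≡⟨ cong (_% ℓ) (+-assoc i ℓ (toℕ j)) ⟩
    (i + (ℓ + toℕ j)) % ℓ ≡⟨ cong (λ m → (i + m) % ℓ) (+-comm ℓ (toℕ j)) ⟩
    (i + (toℕ j + ℓ)) % ℓ ≡⟨ cong (_% ℓ) (+-assoc i (toℕ j) ℓ) ⟨
    (i + toℕ j + ℓ) % ℓ   ≡⟨ [m+n]%n≡m%n (i + toℕ j) ℓ ⟩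
    (i + toℕ j) % ℓ       ∎) _ _)
    where open ≡-Reasoning

  fac-fac : ∀ {μ} .{{_ : NonZero μ}} (a : Word σ ℓ) p l j → j + l ≤ μ →
            fac (fac a p μ) j l ≡ fac a (p + j) l
  fac-fac {μ} a p l j j+l≤μ = tabulate-cong λ t → begin
    lookup (fac a p μ) ((j + toℕ t) mod μ) ≡⟨ lookup∘tabulate _ ((j + toℕ t) mod μ) ⟩
    cyc a (p + toℕ ((j + toℕ t) mod μ))    ≡⟨ cong (λ m → cyc a (p + m)) (trans (FinP.toℕ-fromℕ< _) (m<n⇒m%n≡m (j+t<μ t))) ⟩
    cyc a (p + (j + toℕ t))                ≡⟨ cong (cyc a) (+-assoc p j (toℕ t)) ⟨
    cyc a (p + j + toℕ t)                  ∎
    where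
    open ≡-Reasoning
    j+t<μ : ∀ t → j + toℕ t < μ
    j+t<μ t = ≤-trans (+-monoʳ-< j (FinP.toℕ<n t)) j+l≤μ

  subword-factors≤occurrences : ∀ {μ} .{{_ : NonZero μ}} (a : Word σ ℓ) p (u : Vec (Fin σ) μ) →
    fac a p μ ≡ u → μ ≤ ℓ → ∀ t → suc t ≤ μ → ∀ w →
    multiplicity w (applyDownFrom (λ j → fac u j (suc t)) (μ ∸ t)) ≤ occurrences (λ i → fac a i (suc t)) w ℓ
  subword-factors≤occurrences {μ} a p u a[p]≡u μ≤ℓ t t<μ w = begin
    multiplicity w (applyDownFrom (λ j → fac u j (suc t)) (μ ∸ t))
      ≡⟨ multiplicity-applyDownFrom _ w (μ ∸ t) ⟩
    occurrences (λ j → fac u j (suc t)) w (μ ∸ t)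
      ≡⟨ occurrences-cong w (μ ∸ t) factor-of-u ⟩
    occurrences (λ j → fac a (p + j) (suc t)) w (μ ∸ t)
      ≤⟨ count-monoʳ-≤ _ (≤-trans (m∸n≤m μ t) μ≤ℓ) ⟩
    occurrences (λ j → fac a (p + j) (suc t)) w ℓ
      ≡⟨ occurrences-rotate (λ i → fac a i (suc t)) w ℓ p (λ i → fac-periodic a i (suc t)) ⟩
    occurrences (λ i → fac a i (suc t)) w ℓ ∎
    where
    open ≤-Reasoning
    factor-of-u : ∀ j → j < μ ∸ t → fac u j (suc t) ≡ fac a (p + j) (suc t)
    factor-of-u j j<μ∸t = trans (cong (λ x → fac x j (suc t)) (sym a[p]≡u)) (fac-fac a p (suc t) j j+1+t≤μ)
      where
      j+1+t≤μ : j + suc t ≤ μ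
      j+1+t≤μ = subst (_≤ μ) (sym (+-suc j t)) (m≤o∸n⇒m+n≤o (suc j) (<⇒≤ t<μ) j<μ∸t)

  shared-subword⇒count-inM : ∀ {μ} .{{_ : NonZero μ}} (a b : Word σ ℓ) (u : Vec (Fin σ) μ) →
    SubwordOf u a → SubwordOf u b → ∀ t → suc t ≤ μ → μ ∸ t ≤ count (inM a b (suc t)) ℓ
  shared-subword⇒count-inM {μ} a b u (μ≤ℓ , p , _ , a[p]≡u) (_ , q , _ , b[q]≡u) t t<μ =
    subst (_≤ count (inM a b (suc t)) ℓ) (length-applyDownFrom (λ j → fac u j (suc t)) (μ ∸ t))
      (common-factors≤count-inM a b (suc t) (applyDownFrom (λ j → fac u j (suc t)) (μ ∸ t))
        (subword-factors≤occurrences a p u a[p]≡u μ≤ℓ t t<μ)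
        (subword-factors≤occurrences b q u b[q]≡u μ≤ℓ t t<μ))

  shared-subword⇒interSize : ∀ {μ} .{{_ : NonZero μ}} (a b : Word σ ℓ) (u : Vec (Fin σ) μ) →
    SubwordOf u a → SubwordOf u b → μ * suc μ ≤ 2 * interSize a b
  shared-subword⇒interSize {μ} a b u u⊑a u⊑b = begin
    μ * suc μ                                ≡⟨ double-sumLen-descending μ ⟨
    2 * sumLen (λ l → suc μ ∸ l) μ           ≤⟨ *-monoʳ-≤ 2 (sumLen-monoˡ-≤ μ (shared-subword⇒count-inM a b u u⊑a u⊑b)) ⟩
    2 * sumLen (λ l → count (inM a b l) ℓ) μ ≤⟨ *-monoʳ-≤ 2 (sumLen-monoʳ-≤ _ (proj₁ u⊑a)) ⟩
    2 * interSize a b                        ∎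
    where open ≤-Reasoning

  overlapDist-≤-bound : ∀ (a b : Word σ ℓ) μ .{{_ : NonZero μ}} → μ * suc μ ≤ 2 * interSize a b →
                        Σ ℚ λ q → overlapDist a b ≡ just q × q ≤ℚ bound ℓ μ
  overlapDist-≤-bound a b (suc m) μ[μ+1]≤2I with interSize a b
  ... | zero = contradiction μ[μ+1]≤2I λ ()
  ... | suc j with suc j ≟ℕ ℓ * ℓ
  ...   | yes _ = 0ℚ , refl , subst (_≤ℚ bound ℓ (suc m)) (0/n≡0 1) (*≤*⇒/≤/ 0 0 (2 * ℓ * ℓ) _ z≤n)
  ...   | no _ = _ , refl , *≤*⇒/≤/ (ℓ * ℓ) j (2 * ℓ * ℓ) _ (begin
    ℓ * ℓ * (suc m * suc (suc m)) ≤⟨ *-monoʳ-≤ (ℓ * ℓ) μ[μ+1]≤2I ⟩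
    ℓ * ℓ * (2 * suc j)           ≡⟨ solve 2 (λ ℓ j → ℓ :* ℓ :* (con 2 :* (con 1 :+ j)) := con 2 :* ℓ :* ℓ :* (con 1 :+ j)) refl ℓ j ⟩
    2 * ℓ * ℓ * suc j             ∎)
    where open ≤-Reasoning

lemma1 : (σ ℓ : ℕ) .{{_ : NonZero ℓ}} (L : List (Word σ ℓ)) → Unique L → All IsNecklace L →
    (k : ℕ) .{{_ : NonZero k}} (S : List (Word σ ℓ)) → IsCentreSet L k S →
    (λ' : ℕ) .{{_ : NonZero λ'}} → AllShare L S λ' → (∀ μ → λ' < μ → ¬ AllShare L S μ) →
    OptAtMost L k (bound ℓ λ')
lemma1 σ ℓ L _ _ k S S-centres λ' all-share _ = S , S-centres , λ {v} v∈L →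
  let (s , s∈S , u , u⊑s , u⊑v) = all-share v∈L
  in s , s∈S , overlapDist-≤-bound s v λ' (shared-subword⇒interSize s v u u⊑s u⊑v)
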